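{- For every integer $a\ge2$, the game Wyt$(a)$ is strongly miserable.
   Context: Wyt$(a)$ (for a positive integer $a$): positions are pairs of non-negative integers (two piles); a move either removes a positive number of tokens from one pile, or removes $k$ tokens from one pile and $l$ tokens from the other, where $k,l$ are non-negative integers, not both zero, not exceeding the respective pile sizes, with $|k-l|<a$. $\operatorname{mex}(S)$ is the least non-negative integer not in $S$; the normal Sprague–Grundy function is $\mathcal{G}(x)=\operatorname{mex}\{\mathcal{G}(y): x\to y\}$ (so $0$ on terminal positions); the misère function $\mathcal{G}^-$ satisfies $\mathcal{G}^-(x)=1$ for terminal $x$ and $\mathcal{G}^-(x)=\operatorname{mex}\{\mathcal{G}^-(y): x\to y\}$ otherwise. $V_{i,j}$ is the set of positions with $\mathcal{G}=i$, $\mathcal{G}^-=j$. A game is strongly miserable if every position $x$ either lies in $V_{0,1}\cup V_{1,0}$ or has a move to a position of $V_{0,1}$ and a move to a position of $V_{1,0}$. -}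

module Defs where

open import Data.Nat using (ℕ; zero; suc; _+_; _∸_; _≤_; _<_; ∣_-_∣; _≡ᵇ_; _<ᵇ_)
open import Data.Bool using (Bool; true; false; if_then_else_; _∧_; _∨_; not)
open import Data.List using (List; []; _∷_; length; map; concatMap; upTo)
open import Data.Bool.ListAction using (any)
open import Data.Product using (_×_; _,_; ∃-syntax)
open import Data.Sum using (_⊎_)
open import Relation.Binary.PropositionalEquality using (_≡_)

Pos : Set
Pos = ℕ × ℕ

-- (k , l) is a legal removal amount in Wyt(a):
-- not both zero, and either one of them is zero (single-pile move)
-- or |k - l| < a (two-pile move).  (A two-pile move with one part 0
-- is a single-pile move, so this covers exactly the moves of Wyt(a).)
Legal : ℕ → ℕ → ℕ → Set
Legal a k l = (0 < k + l) × ((k ≡ 0) ⊎ (l ≡ 0) ⊎ (∣ k - l ∣ < a))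

Move : ℕ → Pos → Pos → Set
Move a (x , y) q = ∃[ k ] ∃[ l ] (k ≤ x × l ≤ y × Legal a k l × q ≡ (x ∸ k , y ∸ l))

legalᵇ : ℕ → ℕ → ℕ → Bool
legalᵇ a k l = not ((k ≡ᵇ 0) ∧ (l ≡ᵇ 0)) ∧ ((k ≡ᵇ 0) ∨ (l ≡ᵇ 0) ∨ (∣ k - l ∣ <ᵇ a))

filterB : {A : Set} → (A → Bool) → List A → List A
filterB p [] = []
filterB p (x ∷ xs) = if p x then x ∷ filterB p xs else filterB p xs

options : ℕ → Pos → List Pos
options a (x , y) =
  map (λ kl → (x ∸ Data.Product.proj₁ kl , y ∸ Data.Product.proj₂ kl))
      (filterB (λ kl → legalᵇ a (Data.Product.proj₁ kl) (Data.Product.proj₂ kl))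
               (concatMap (λ k → map (λ l → (k , l)) (upTo (suc y))) (upTo (suc x))))

elemᵇ : ℕ → List ℕ → Bool
elemᵇ n xs = any (λ m → m ≡ᵇ n) xs

mexAux : ℕ → ℕ → List ℕ → ℕ
mexAux zero n xs = n
mexAux (suc f) n xs = if elemᵇ n xs then mexAux f (suc n) xs else n

mex : List ℕ → ℕ
mex xs = mexAux (suc (length xs)) 0 xs

size : Pos → ℕ
size (x , y) = x + y

-- Fuelled Sprague–Grundy functions; every move strictly decreases
-- x + y, so fuel x + y + 1 suffices.
sgF : ℕ → ℕ → Pos → ℕ
sgF a zero p = 0
sgF a (suc f) p = mex (map (sgF a f) (options a p))

misF : ℕ → ℕ → Pos → ℕ
misF a zero p = 1
misF a (suc f) p with options a p
... | [] = 1
... | os@(_ ∷ _) = mex (map (misF a f) os)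

SG : ℕ → Pos → ℕ
SG a p = sgF a (suc (size p)) p

SG⁻ : ℕ → Pos → ℕ
SG⁻ a p = misF a (suc (size p)) p

V : ℕ → ℕ → ℕ → Pos → Set
V a i j p = (SG a p ≡ i) × (SG⁻ a p ≡ j)

StronglyMiserable : ℕ → Set
StronglyMiserable a = (p : Pos) →
  (V a 0 1 p ⊎ V a 1 0 p) ⊎
  ((∃[ q ] (Move a p q × V a 0 1 q)) × (∃[ q ] (Move a p q × V a 1 0 q)))

-- Let A be the set of pairs (Xₙ, Xₙ + na) and their mirror images, where
-- Xₙ = mex {Xᵢ, Yᵢ : i < n} (the P-positions of Wyt(a)), and let B be built by the
-- same recursion with offset na + 1.  Neither set contains a move, and every position
-- outside A, resp. outside B ∪ {(0, 0)}, has a move into it; for a ≥ 2 the two sets are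
-- moreover disjoint.  For any two sets of this kind, induction over positions shows that
-- 𝒢 is 0 exactly on A and 1 exactly on B, and that 𝒢⁻ is 𝒢 with the values 0 and 1
-- interchanged.  So A = V₀,₁ and B = V₁,₀, and every other position moves into both.

module Submission where

open import Defs
open import Data.Nat
open import Data.Nat.Properties
open import Data.Nat.DivMod
open import Data.Nat.Induction using (<-wellFounded)
open import Induction.WellFounded using (Acc; acc)
open import Data.Nat.Tactic.RingSolver using (solve-∀)
open import Data.Bool using (Bool; true; false; T; if_then_else_; _∨_)
open import Data.Bool.Properties using (T-∨)
open import Data.Unit using (tt)
open import Data.List using (List; []; _∷_; map; length; upTo; concatMap)
open import Data.List.Properties using (length-map; map-cong-local; map-∘)
open import Data.List.Relation.Unary.All using (tabulate)
open import Data.List.Relation.Unary.Any as Any using (here; there)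
open import Data.List.Relation.Unary.Any.Properties using (any⁺; any⁻)
open import Data.List.Membership.Propositional using (_∈_; _∉_; find; lose)
open import Data.List.Membership.Propositional.Properties
  using (∈-map⁺; ∈-map⁻; ∈-upTo⁺; ∈-upTo⁻; ∈-concatMap⁺; ∈-concatMap⁻)
open import Data.Product as Product using (_×_; _,_; ∃-syntax; proj₁; proj₂)
open import Data.Product.Properties using (,-injectiveˡ; ,-injectiveʳ)
open import Data.Sum as Sum using (_⊎_; inj₁; inj₂)
open import Data.Empty using (⊥; ⊥-elim)
open import Function using (_∘_; _∘′_; _⇔_; mk⇔; Equivalence)
open import Relation.Nullary using (¬_; yes; no)
open import Relation.Binary.PropositionalEquality
open import Relation.Binary.Definitions using (tri<; tri≈; tri>)

Legal-swap : ∀ {a k l} → Legal a k l → Legal a l k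
Legal-swap {k = k} {l} (k+l>0 , inj₁ k≡0)        = subst (0 <_) (+-comm k l) k+l>0 , inj₂ (inj₁ k≡0)
Legal-swap {k = k} {l} (k+l>0 , inj₂ (inj₁ l≡0)) = subst (0 <_) (+-comm k l) k+l>0 , inj₁ l≡0
Legal-swap {k = k} {l} (k+l>0 , inj₂ (inj₂ d<a)) =
  subst (0 <_) (+-comm k l) k+l>0 , inj₂ (inj₂ (subst (_< _) (∣-∣-comm k l) d<a))

Legal-twoPile : ∀ {a k l} → 0 < k → ∣ k - l ∣ < a → Legal a k l
Legal-twoPile {k = suc k} _ d<a = z<s , inj₂ (inj₂ d<a)

Legal-single : ∀ {a} k → Legal a 0 (suc k)
Legal-single k = z<s , inj₁ refl

Legal-adjacent : ∀ {a} → 2 ≤ a → ∀ x → Legal a (suc x) x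
Legal-adjacent 2≤a x = Legal-twoPile z<s (subst (_< _) (sym (∣1+n-n∣≡1 x)) 2≤a)
  where
    ∣1+n-n∣≡1 : ∀ n → ∣ suc n - n ∣ ≡ 1
    ∣1+n-n∣≡1 zero    = refl
    ∣1+n-n∣≡1 (suc n) = ∣1+n-n∣≡1 n

Legal-far⇒k≡0 : ∀ {a k s} → a ≤ s → Legal a k (k + s) → k ≡ 0
Legal-far⇒k≡0 _ (_ , inj₁ k≡0) = k≡0
Legal-far⇒k≡0 _ (_ , inj₂ (inj₁ k+s≡0)) = m+n≡0⇒m≡0 _ k+s≡0
Legal-far⇒k≡0 {k = k} {s} a≤s (_ , inj₂ (inj₂ d<a)) =
  ⊥-elim (<⇒≱ (subst (_< _) (∣m-m+n∣≡n k s) d<a) a≤s)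

move-intro : ∀ {a x y x′ y′ k l} → x ≡ x′ + k → y ≡ y′ + l → Legal a k l → Move a (x , y) (x′ , y′)
move-intro {x′ = x′} {y′} {k} {l} refl refl legal =
  k , l , m≤n+m k x′ , m≤n+m l y′ , legal , cong₂ _,_ (sym (m+n∸n≡m x′ k)) (sym (m+n∸n≡m y′ l))

move-elim : ∀ {a x y x′ y′} → Move a (x , y) (x′ , y′) →
            ∃[ k ] ∃[ l ] (x ≡ x′ + k × y ≡ y′ + l × Legal a k l)
move-elim (k , l , k≤x , l≤y , legal , refl) =
  k , l , sym (m∸n+n≡m k≤x) , sym (m∸n+n≡m l≤y) , legal

Move-swap : ∀ {a x y x′ y′} → Move a (x , y) (x′ , y′) → Move a (y , x) (y′ , x′)
Move-swap m with k , l , x≡ , y≡ , legal ← move-elim m = move-intro y≡ x≡ (Legal-swap legal)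

Move-size : ∀ {a p q} → Move a p q → size q < size p
Move-size {p = x , y} {x′ , y′} m with k , l , refl , refl , (k+l>0 , _) ← move-elim m = begin-strict
  x′ + y′             ≡⟨ +-identityʳ _ ⟨
  x′ + y′ + 0         <⟨ +-monoʳ-< (x′ + y′) k+l>0 ⟩
  x′ + y′ + (k + l)   ≡⟨ regroup x′ y′ k l ⟩
  x′ + k + (y′ + l)   ∎
  where
    open ≤-Reasoning
    regroup : ∀ x y k l → x + y + (k + l) ≡ x + k + (y + l)
    regroup = solve-∀

origin-terminal : ∀ {a q} → ¬ Move a (0 , 0) q
origin-terminal m = <⇒≱ (Move-size m) z≤n

∈-filterB⁺ : ∀ {A : Set} (p : A → Bool) {x xs} → x ∈ xs → T (p x) → x ∈ filterB p xs
∈-filterB⁺ p {xs = y ∷ _} (here refl) px with p y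
... | true = here refl
∈-filterB⁺ p {xs = y ∷ _} (there x∈) px with p y
... | true  = there (∈-filterB⁺ p x∈ px)
... | false = ∈-filterB⁺ p x∈ px

∈-filterB⁻ : ∀ {A : Set} (p : A → Bool) {x} xs → x ∈ filterB p xs → x ∈ xs × T (p x)
∈-filterB⁻ p (y ∷ ys) x∈ with p y in py
∈-filterB⁻ p (y ∷ ys) (here refl) | true = here refl , subst T (sym py) tt
∈-filterB⁻ p (y ∷ ys) (there x∈)  | true = let x∈ys , px = ∈-filterB⁻ p ys x∈ in there x∈ys , px
∈-filterB⁻ p (y ∷ ys) x∈          | false = let x∈ys , px = ∈-filterB⁻ p ys x∈ in there x∈ys , px

Legal⇒legalᵇ : ∀ {a} k l → Legal a k l → T (legalᵇ a k l)
Legal⇒legalᵇ zero    (suc l) _ = tt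
Legal⇒legalᵇ (suc k) zero    _ = tt
Legal⇒legalᵇ (suc k) (suc l) (_ , inj₂ (inj₂ d<a)) = <⇒<ᵇ d<a

legalᵇ⇒Legal : ∀ {a} k l → T (legalᵇ a k l) → Legal a k l
legalᵇ⇒Legal zero    (suc l) _ = Legal-single l
legalᵇ⇒Legal (suc k) zero    _ = z<s , inj₂ (inj₁ refl)
legalᵇ⇒Legal (suc k) (suc l) d<a = Legal-twoPile z<s (<ᵇ⇒< _ _ d<a)

private
  removals : ℕ → ℕ → List (ℕ × ℕ)
  removals x y = concatMap (λ k → map (k ,_) (upTo (suc y))) (upTo (suc x))

  ∈-removals⁺ : ∀ {x y k l} → k ≤ x → l ≤ y → (k , l) ∈ removals x y
  ∈-removals⁺ {y = y} {k} k≤x l≤y =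
    ∈-concatMap⁺ (λ k → map (k ,_) (upTo (suc y)))
      (lose (∈-upTo⁺ (s≤s k≤x)) (∈-map⁺ (k ,_) (∈-upTo⁺ (s≤s l≤y))))

  ∈-removals⁻ : ∀ {x y k l} → (k , l) ∈ removals x y → k ≤ x × l ≤ y
  ∈-removals⁻ {x} {y} kl∈
    with k , k∈ , kl∈ₖ ← find (∈-concatMap⁻ (λ k → map (k ,_) (upTo (suc y))) {xs = upTo (suc x)} kl∈)
    with l , l∈ , refl ← ∈-map⁻ (k ,_) kl∈ₖ
    = s≤s⁻¹ (∈-upTo⁻ k∈) , s≤s⁻¹ (∈-upTo⁻ l∈)

options-sound : ∀ {a p q} → q ∈ options a p → Move a p q
options-sound {a} {x , y} q∈
  with (k , l) , kl∈ , refl ← ∈-map⁻ (λ (k , l) → (x ∸ k , y ∸ l)) q∈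
  with kl∈removals , legal ← ∈-filterB⁻ (λ (k , l) → legalᵇ a k l) (removals x y) kl∈
  with k≤x , l≤y ← ∈-removals⁻ kl∈removals
  = k , l , k≤x , l≤y , legalᵇ⇒Legal k l legal , refl

options-complete : ∀ {a p q} → Move a p q → q ∈ options a p
options-complete {a} {x , y} (k , l , k≤x , l≤y , legal , refl) =
  ∈-map⁺ (λ (k , l) → (x ∸ k , y ∸ l))
    (∈-filterB⁺ (λ (k , l) → legalᵇ a k l) (∈-removals⁺ k≤x l≤y) (Legal⇒legalᵇ k l legal))

∈⇒elemᵇ : ∀ {v xs} → v ∈ xs → T (elemᵇ v xs)
∈⇒elemᵇ {v} v∈ = any⁺ _ (Any.map (λ { refl → ≡⇒≡ᵇ v v refl }) v∈)

elemᵇ⇒∈ : ∀ {v} xs → T (elemᵇ v xs) → v ∈ xs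
elemᵇ⇒∈ {v} xs e = Any.map (λ {m} m≡ᵇv → sym (≡ᵇ⇒≡ m v m≡ᵇv)) (any⁻ _ xs e)

elemᵇ-true : ∀ {v xs} → v ∈ xs → elemᵇ v xs ≡ true
elemᵇ-true {v} {xs} v∈ with elemᵇ v xs | ∈⇒elemᵇ v∈
... | true | _ = refl

elemᵇ-false : ∀ {v xs} → v ∉ xs → elemᵇ v xs ≡ false
elemᵇ-false {v} {xs} v∉ with elemᵇ v xs in e
... | true  = ⊥-elim (v∉ (elemᵇ⇒∈ xs (subst T (sym e) tt)))
... | false = refl

mex≡0 : ∀ {xs} → 0 ∉ xs → mex xs ≡ 0
mex≡0 0∉ rewrite elemᵇ-false 0∉ = refl

mex≡1 : ∀ {xs} → 0 ∈ xs → 1 ∉ xs → mex xs ≡ 1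
mex≡1 {_ ∷ _} 0∈ 1∉ rewrite elemᵇ-true 0∈ | elemᵇ-false 1∉ = refl

mexAux-≥ : ∀ f n xs → n ≤ mexAux f n xs
mexAux-≥ zero    n xs = ≤-refl
mexAux-≥ (suc f) n xs with elemᵇ n xs
... | true  = ≤-trans (n≤1+n n) (mexAux-≥ f (suc n) xs)
... | false = ≤-refl

mex≥2 : ∀ {xs} → 0 ∈ xs → 1 ∈ xs → 2 ≤ mex xs
mex≥2 {y ∷ ys} 0∈ 1∈ rewrite elemᵇ-true 0∈ | elemᵇ-true 1∈ = mexAux-≥ (length ys) 2 (y ∷ ys)

mexAux-cong : ∀ f n {xs ys} → (∀ v → v ∈ xs → v ∈ ys) → (∀ v → v ∈ ys → v ∈ xs) →
              mexAux f n xs ≡ mexAux f n ys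
mexAux-cong zero    n xs⊆ys ys⊆xs = refl
mexAux-cong (suc f) n {xs} {ys} xs⊆ys ys⊆xs with elemᵇ n xs in ex | elemᵇ n ys in ey
... | true  | true  = mexAux-cong f (suc n) xs⊆ys ys⊆xs
... | false | false = refl
... | true  | false = ⊥-elim (subst T ey (∈⇒elemᵇ (xs⊆ys n (elemᵇ⇒∈ xs (subst T (sym ex) tt)))))
... | false | true  = ⊥-elim (subst T ex (∈⇒elemᵇ (ys⊆xs n (elemᵇ⇒∈ ys (subst T (sym ey) tt)))))

mex-cong : ∀ {xs ys} → length xs ≡ length ys →
           (∀ v → v ∈ xs → v ∈ ys) → (∀ v → v ∈ ys → v ∈ xs) → mex xs ≡ mex ys
mex-cong {xs} {ys} |xs|≡|ys| xs⊆ys ys⊆xs =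
  subst (λ f → mexAux (suc f) 0 xs ≡ mex ys) (sym |xs|≡|ys|) (mexAux-cong (suc (length ys)) 0 xs⊆ys ys⊆xs)

swap01 : ℕ → ℕ
swap01 0 = 1
swap01 1 = 0
swap01 n@(suc (suc _)) = n

swap01-involutive : ∀ n → swap01 (swap01 n) ≡ n
swap01-involutive 0 = refl
swap01-involutive 1 = refl
swap01-involutive (suc (suc _)) = refl

swap01-≥2 : ∀ {n} → 2 ≤ n → swap01 n ≡ n
swap01-≥2 (s≤s (s≤s _)) = refl

mex-swap01 : ∀ {xs} → 0 ∈ xs → 1 ∈ xs → mex (map swap01 xs) ≡ mex xs
mex-swap01 {xs} 0∈ 1∈ = mex-cong (length-map swap01 xs) swapped⊆ ⊆swapped
  where
    swap01-closed : ∀ {v} → v ∈ xs → swap01 v ∈ xs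
    swap01-closed {0} _ = 1∈
    swap01-closed {1} _ = 0∈
    swap01-closed {suc (suc _)} v∈ = v∈

    swapped⊆ : ∀ v → v ∈ map swap01 xs → v ∈ xs
    swapped⊆ v v∈ with u , u∈ , refl ← ∈-map⁻ swap01 v∈ = swap01-closed u∈

    ⊆swapped : ∀ v → v ∈ xs → v ∈ map swap01 xs
    ⊆swapped v v∈ = subst (_∈ map swap01 xs) (swap01-involutive v) (∈-map⁺ swap01 (swap01-closed v∈))

mex⁻ : List ℕ → ℕ
mex⁻ [] = 1
mex⁻ xs@(_ ∷ _) = mex xs

mex⁻-nonempty : ∀ {v xs} → v ∈ xs → mex⁻ xs ≡ mex xs
mex⁻-nonempty (here _)  = refl
mex⁻-nonempty (there _) = refl

module _ (a : ℕ) (Φ : List ℕ → ℕ) (F : ℕ → Pos → ℕ)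
         (F-suc : ∀ f p → F (suc f) p ≡ Φ (map (F f) (options a p))) where

  fuel-irrelevant : ∀ f g p → size p < f → size p < g → F f p ≡ F g p
  fuel-irrelevant (suc f) (suc g) p (s≤s p≤f) (s≤s p≤g) = begin
    F (suc f) p                 ≡⟨ F-suc f p ⟩
    Φ (map (F f) (options a p)) ≡⟨ cong Φ (map-cong-local (tabulate F-agrees)) ⟩
    Φ (map (F g) (options a p)) ≡⟨ F-suc g p ⟨
    F (suc g) p                 ∎
    where
      open ≡-Reasoning
      F-agrees : ∀ {q} → q ∈ options a p → F f q ≡ F g q
      F-agrees q∈ = let q<p = Move-size (options-sound {a} q∈) in
        fuel-irrelevant f g _ (<-≤-trans q<p p≤f) (<-≤-trans q<p p≤g)

  fuel-unfold : ∀ p → F (suc (size p)) p ≡ Φ (map (λ q → F (suc (size q)) q) (options a p))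
  fuel-unfold p = trans (F-suc (size p) p) (cong Φ (map-cong-local (tabulate enough-fuel)))
    where
      enough-fuel : ∀ {q} → q ∈ options a p → F (size p) q ≡ F (suc (size q)) q
      enough-fuel {q} q∈ = fuel-irrelevant (size p) (suc (size q)) q (Move-size (options-sound {a} q∈)) ≤-refl

misF-suc : ∀ a f p → misF a (suc f) p ≡ mex⁻ (map (misF a f) (options a p))
misF-suc a f p with options a p
... | []    = refl
... | _ ∷ _ = refl

SG-rec : ∀ a p → SG a p ≡ mex (map (SG a) (options a p))
SG-rec a = fuel-unfold a mex (sgF a) (λ _ _ → refl)

SG⁻-rec : ∀ a p → SG⁻ a p ≡ mex⁻ (map (SG⁻ a) (options a p))
SG⁻-rec a = fuel-unfold a mex⁻ (misF a) (misF-suc a)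

Independent : ℕ → (Pos → Set) → Set
Independent a S = ∀ {p q} → S p → S q → ¬ Move a p q

Absorbed : ℕ → (Pos → Set) → Pos → Set
Absorbed a S p = S p ⊎ ∃[ q ] (Move a p q × S q)

option-value : ∀ {a p q v} (g : Pos → ℕ) → Move a p q → g q ≡ v → v ∈ map g (options a p)
option-value g m refl = ∈-map⁺ g (options-complete m)

option-value⁻ : ∀ {a p v} (g : Pos → ℕ) → v ∈ map g (options a p) → ∃[ q ] (Move a p q × g q ≡ v)
option-value⁻ {a} g v∈ with q , q∈ , refl ← ∈-map⁻ g v∈ = q , options-sound {a} q∈ , refl

module TwoKernels (a : ℕ) (A B : Pos → Set)
  (A-independent : Independent a A) (B-independent : Independent a B)
  (A-absorbing : ∀ p → Absorbed a A p)
  (B-absorbing : ∀ p → p ≡ (0 , 0) ⊎ Absorbed a B p)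
  (A-B-disjoint : ∀ {p} → A p → ¬ B p) where

  record Classified (p : Pos) : Set where
    field
      A⇔SG≡0 : A p ⇔ (SG a p ≡ 0)
      B⇔SG≡1 : B p ⇔ (SG a p ≡ 1)
      SG⁻≡swap01-SG : SG⁻ a p ≡ swap01 (SG a p)

  open Classified
  open Equivalence using (to; from)

  private
    neither : ∀ {P Q : Set} → ¬ P → ¬ Q → P ⇔ Q
    neither ¬P ¬Q = mk⇔ (⊥-elim ∘′ ¬P) (⊥-elim ∘′ ¬Q)

    both : ∀ {P Q : Set} → P → Q → P ⇔ Q
    both p q = mk⇔ (λ _ → q) (λ _ → p)

  A⇒V₀₁ : ∀ {p} → Classified p → A p → V a 0 1 p
  A⇒V₀₁ cp pA = let SG≡0 = to (A⇔SG≡0 cp) pA in SG≡0 , trans (SG⁻≡swap01-SG cp) (cong swap01 SG≡0)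

  B⇒V₁₀ : ∀ {p} → Classified p → B p → V a 1 0 p
  B⇒V₁₀ cp pB = let SG≡1 = to (B⇔SG≡1 cp) pB in SG≡1 , trans (SG⁻≡swap01-SG cp) (cong swap01 SG≡1)

  SG⁻≡swap01⇒SG : ∀ {p v} → Classified p → SG⁻ a p ≡ swap01 v → SG a p ≡ v
  SG⁻≡swap01⇒SG {p} {v} cp e = begin
    SG a p                    ≡⟨ swap01-involutive (SG a p) ⟨
    swap01 (swap01 (SG a p))  ≡⟨ cong swap01 (trans (sym (SG⁻≡swap01-SG cp)) e) ⟩
    swap01 (swap01 v)         ≡⟨ swap01-involutive v ⟩
    v                         ∎
    where open ≡-Reasoning

  SG⁻≡1⇒A : ∀ {p} → Classified p → SG⁻ a p ≡ 1 → A p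
  SG⁻≡1⇒A cp e = from (A⇔SG≡0 cp) (SG⁻≡swap01⇒SG cp e)

  SG⁻≡0⇒B : ∀ {p} → Classified p → SG⁻ a p ≡ 0 → B p
  SG⁻≡0⇒B cp e = from (B⇔SG≡1 cp) (SG⁻≡swap01⇒SG cp e)

  OptionsClassified : Pos → Set
  OptionsClassified p = ∀ {q} → Move a p q → Classified q

  module _ {p : Pos} (IH : OptionsClassified p) where

    options-avoid : ∀ {S : Pos → Set} {v} (g : Pos → ℕ) → Independent a S → S p →
                    (∀ {q} → Classified q → g q ≡ v → S q) → v ∉ map g (options a p)
    options-avoid g S-independent Sp g≡v⇒S v∈ with q , m , gq≡v ← option-value⁻ g v∈ =
      S-independent Sp (g≡v⇒S (IH m) gq≡v) m

    classified-A : A p → Classified p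
    classified-A pA = record
      { A⇔SG≡0 = both pA SG≡0
      ; B⇔SG≡1 = neither (A-B-disjoint pA) (λ SG≡1 → 0≢1+n (trans (sym SG≡0) SG≡1))
      ; SG⁻≡swap01-SG = trans SG⁻≡1 (cong swap01 (sym SG≡0))
      }
      where
        SG≡0 : SG a p ≡ 0
        SG≡0 = trans (SG-rec a p) (mex≡0 (options-avoid (SG a) A-independent pA (from ∘ A⇔SG≡0)))

        SG⁻≡1 : SG⁻ a p ≡ 1
        SG⁻≡1 with B-absorbing p
        ... | inj₁ refl = refl
        ... | inj₂ (inj₁ pB) = ⊥-elim (A-B-disjoint pA pB)
        ... | inj₂ (inj₂ (q , m , qB)) = begin
          SG⁻ a p                          ≡⟨ SG⁻-rec a p ⟩
          mex⁻ (map (SG⁻ a) (options a p)) ≡⟨ mex⁻-nonempty 0∈ ⟩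
          mex (map (SG⁻ a) (options a p))  ≡⟨ mex≡1 0∈ 1∉ ⟩
          1                                ∎
          where
            open ≡-Reasoning
            0∈ = option-value (SG⁻ a) m (proj₂ (B⇒V₁₀ (IH m) qB))
            1∉ = options-avoid (SG⁻ a) A-independent pA SG⁻≡1⇒A

    classified-B : ∀ {q} → B p → Move a p q → A q → Classified p
    classified-B pB m qA = record
      { A⇔SG≡0 = neither (λ pA → A-B-disjoint pA pB) (λ SG≡0 → 0≢1+n (trans (sym SG≡0) SG≡1))
      ; B⇔SG≡1 = both pB SG≡1
      ; SG⁻≡swap01-SG = trans SG⁻≡0 (cong swap01 (sym SG≡1))
      }
      where
        SG≡1 : SG a p ≡ 1
        SG≡1 = trans (SG-rec a p)
          (mex≡1 (option-value (SG a) m (proj₁ (A⇒V₀₁ (IH m) qA)))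
                 (options-avoid (SG a) B-independent pB (from ∘ B⇔SG≡1)))

        SG⁻≡0 : SG⁻ a p ≡ 0
        SG⁻≡0 = trans (SG⁻-rec a p) (trans (mex⁻-nonempty (option-value (SG⁻ a) m refl))
          (mex≡0 (options-avoid (SG⁻ a) B-independent pB SG⁻≡0⇒B)))

    classified-rest : ∀ {q r} → Move a p q → A q → Move a p r → B r → Classified p
    classified-rest mA qA mB rB = record
      { A⇔SG≡0 = neither (λ pA → A-independent pA qA mA) (λ SG≡0 → <⇒≱ z<s (subst (2 ≤_) SG≡0 SG≥2))
      ; B⇔SG≡1 = neither (λ pB → B-independent pB rB mB) (λ SG≡1 → <⇒≱ ≤-refl (subst (2 ≤_) SG≡1 SG≥2))
      ; SG⁻≡swap01-SG = trans SG⁻≡SG (sym (swap01-≥2 SG≥2))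
      }
      where
        open ≡-Reasoning
        os = options a p
        0∈ = option-value (SG a) mA (proj₁ (A⇒V₀₁ (IH mA) qA))
        1∈ = option-value (SG a) mB (proj₁ (B⇒V₁₀ (IH mB) rB))

        options-swap01 : ∀ {q} → q ∈ os → SG⁻ a q ≡ swap01 (SG a q)
        options-swap01 = SG⁻≡swap01-SG ∘ IH ∘ options-sound {a}

        SG≥2 : 2 ≤ SG a p
        SG≥2 = subst (2 ≤_) (sym (SG-rec a p)) (mex≥2 0∈ 1∈)

        SG⁻≡SG : SG⁻ a p ≡ SG a p
        SG⁻≡SG = begin
          SG⁻ a p                          ≡⟨ SG⁻-rec a p ⟩
          mex⁻ (map (SG⁻ a) os)            ≡⟨ mex⁻-nonempty (option-value (SG⁻ a) mA refl) ⟩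
          mex (map (SG⁻ a) os)             ≡⟨ cong mex (map-cong-local (tabulate options-swap01)) ⟩
          mex (map (swap01 ∘ SG a) os)     ≡⟨ cong mex (map-∘ os) ⟩
          mex (map swap01 (map (SG a) os)) ≡⟨ mex-swap01 0∈ 1∈ ⟩
          mex (map (SG a) os)              ≡⟨ SG-rec a p ⟨
          SG a p                           ∎

    classified-step : Classified p
    classified-step with A-absorbing p | B-absorbing p
    ... | inj₁ pA            | _                         = classified-A pA
    ... | inj₂ (_ , mA , _)  | inj₁ refl                 = ⊥-elim (origin-terminal mA)
    ... | inj₂ (_ , mA , qA) | inj₂ (inj₁ pB)            = classified-B pB mA qA
    ... | inj₂ (_ , mA , qA) | inj₂ (inj₂ (_ , mB , rB)) = classified-rest mA qA mB rB

  classified : ∀ p → Classified p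
  classified p = classified-acc p (<-wellFounded (size p))
    where
      classified-acc : ∀ p → Acc _<_ (size p) → Classified p
      classified-acc p (acc rs) = classified-step (λ m → classified-acc _ (rs (Move-size m)))

  stronglyMiserable : StronglyMiserable a
  stronglyMiserable p with A-absorbing p | B-absorbing p
  ... | inj₁ pA            | _              = inj₁ (inj₁ (A⇒V₀₁ (classified p) pA))
  ... | inj₂ (_ , mA , _)  | inj₁ refl      = ⊥-elim (origin-terminal mA)
  ... | inj₂ _             | inj₂ (inj₁ pB) = inj₁ (inj₂ (B⇒V₁₀ (classified p) pB))
  ... | inj₂ (q , mA , qA) | inj₂ (inj₂ (r , mB , rB)) =
    inj₂ ((q , mA , A⇒V₀₁ (classified q) qA) , (r , mB , B⇒V₁₀ (classified r) rB))

if-cases : ∀ b (x y : ℕ) → (T b × (if b then x else y) ≡ x) ⊎ (¬ T b × (if b then x else y) ≡ y)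
if-cases true  x y = inj₁ (tt , refl)
if-cases false x y = inj₂ ((λ ()) , refl)

-- a′ = a − 1; c = 0 gives the P-positions of Wyt(a), c = 1 the positions of V₁,₀.
module WythoffPairs (a′ c : ℕ) where

  a : ℕ
  a = suc a′

  -- X (1 + n) = mex {Xᵢ, Yᵢ : i ≤ n}: the Yᵢ increase in steps of at least 2 and
  -- X n + 1 exceeds every Xᵢ, so it is X n + 1 unless that value is some Yᵢ.
  mutual
    X : ℕ → ℕ
    X zero    = 0
    X (suc n) = if Y-hit (suc (X n)) n then 2 + X n else suc (X n)

    Y-hit : ℕ → ℕ → Bool
    Y-hit v zero    = c ≡ᵇ v
    Y-hit v (suc n) = (X (suc n) + suc n * a + c ≡ᵇ v) ∨ Y-hit v n

  Y : ℕ → ℕ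
  Y n = X n + n * a + c

  Y-hit-sound : ∀ {v} n → T (Y-hit v n) → ∃[ i ] (i ≤ n × Y i ≡ v)
  Y-hit-sound zero hit = 0 , z≤n , ≡ᵇ⇒≡ c _ hit
  Y-hit-sound (suc n) hit with Equivalence.to T-∨ hit
  ... | inj₁ Yn≡v = suc n , ≤-refl , ≡ᵇ⇒≡ _ _ Yn≡v
  ... | inj₂ hit′ = let i , i≤n , Yi≡v = Y-hit-sound n hit′ in i , m≤n⇒m≤1+n i≤n , Yi≡v

  Y-hit-complete : ∀ {i} n → i ≤ n → T (Y-hit (Y i) n)
  Y-hit-complete zero    z≤n = ≡⇒≡ᵇ c c refl
  Y-hit-complete (suc n) i≤1+n with m≤n⇒m<n∨m≡n i≤1+n
  ... | inj₁ i<1+n = Equivalence.from T-∨ (inj₂ (Y-hit-complete n (s≤s⁻¹ i<1+n)))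
  ... | inj₂ refl  = Equivalence.from T-∨ (inj₁ (≡⇒≡ᵇ (Y (suc n)) _ refl))

  X-suc : ∀ n → (T (Y-hit (suc (X n)) n) × X (suc n) ≡ 2 + X n)
              ⊎ (¬ T (Y-hit (suc (X n)) n) × X (suc n) ≡ suc (X n))
  X-suc n = if-cases (Y-hit (suc (X n)) n) _ _

  X-<-suc : ∀ n → X n < X (suc n)
  X-<-suc n with X-suc n
  ... | inj₁ (_ , X≡) = subst (X n <_) (sym X≡) (m<n⇒m<1+n (n<1+n (X n)))
  ... | inj₂ (_ , X≡) = subst (X n <_) (sym X≡) (n<1+n (X n))

  X-strict : ∀ {m n} → m < n → X m < X n
  X-strict {n = suc n} m<1+n with m≤n⇒m<n∨m≡n (s≤s⁻¹ m<1+n)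
  ... | inj₁ m<n  = <-trans (X-strict m<n) (X-<-suc n)
  ... | inj₂ refl = X-<-suc n

  X-mono : ∀ {m n} → m ≤ n → X m ≤ X n
  X-mono m≤n with m≤n⇒m<n∨m≡n m≤n
  ... | inj₁ m<n  = <⇒≤ (X-strict m<n)
  ... | inj₂ refl = ≤-refl

  n≤X : ∀ n → n ≤ X n
  n≤X zero    = z≤n
  n≤X (suc n) = ≤-trans (s≤s (n≤X n)) (X-<-suc n)

  X≤Y : ∀ n → X n ≤ Y n
  X≤Y n = ≤-trans (m≤m+n (X n) (n * a)) (m≤m+n _ c)

  X<Y : 1 ≤ c → ∀ n → X n < Y n
  X<Y 1≤c n = ≤-trans (subst (_≤ X n + c) (+-comm (X n) 1) (+-monoʳ-≤ (X n) 1≤c))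
                      (+-monoˡ-≤ c (m≤m+n (X n) (n * a)))

  Y-gap : ∀ {j i} → j < i → 2 + Y j ≤ Y i
  Y-gap {j} {i} j<i = begin
    2 + Y j                   ≤⟨ m≤m+n (2 + Y j) a′ ⟩
    2 + Y j + a′              ≡⟨ regroup (X j) (j * a) c a′ ⟩
    suc (X j) + suc j * a + c ≤⟨ +-monoˡ-≤ c (+-mono-≤ (X-strict j<i) (*-monoˡ-≤ a j<i)) ⟩
    Y i                       ∎
    where
      open ≤-Reasoning
      regroup : ∀ x ja c a′ → 2 + (x + ja + c) + a′ ≡ suc x + (suc a′ + ja) + c
      regroup = solve-∀

  Y-strict : ∀ {j i} → j < i → Y j < Y i
  Y-strict j<i = ≤-trans (n≤1+n _) (Y-gap j<i)

  Y-cancel-< : ∀ {j i} → Y j < Y i → j < i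
  Y-cancel-< {j} {i} Yj<Yi with <-cmp j i
  ... | tri< j<i _ _  = j<i
  ... | tri≈ _ refl _ = ⊥-elim (n≮n _ Yj<Yi)
  ... | tri> _ _ i<j  = ⊥-elim (<-asym Yj<Yi (Y-strict i<j))

  X≢Y-earlier : ∀ {i n} → i < n → X n ≢ Y i
  X≢Y-earlier {i} {suc n} (s≤s i≤n) X≡Y with X-suc n
  ... | inj₂ (miss , X≡) = miss (subst (λ v → T (Y-hit v n)) (trans (sym X≡Y) X≡) (Y-hit-complete n i≤n))
  ... | inj₁ (hit , X≡) with j , _ , Yj≡ ← Y-hit-sound n hit =
    1+n≰n (≤-trans (Y-gap j<i) (≤-reflexive Yi≡1+Yj))
    where
      Yi≡1+Yj : Y i ≡ suc (Y j)
      Yi≡1+Yj = trans (sym X≡Y) (trans X≡ (cong suc (sym Yj≡)))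
      j<i : j < i
      j<i = Y-cancel-< (subst (Y j <_) (sym Yi≡1+Yj) (n<1+n _))

  X≡Y⇒origin : ∀ {n m} → X n ≡ Y m → n ≡ 0 × m ≡ 0 × c ≡ 0
  X≡Y⇒origin {n} {m} X≡Y with m <? n
  ... | yes m<n = ⊥-elim (X≢Y-earlier m<n X≡Y)
  ... | no  m≮n = n≡0 , m≡0 , c≡0
    where
      open ≤-Reasoning
      n≤m = ≮⇒≥ m≮n
      ma+c≡0 : m * a + c ≡ 0
      ma+c≡0 = n≤0⇒n≡0 (+-cancelˡ-≤ (X m) _ 0 (begin
        X m + (m * a + c) ≡⟨ +-assoc (X m) _ c ⟨
        Y m               ≡⟨ X≡Y ⟨
        X n               ≤⟨ X-mono n≤m ⟩
        X m               ≡⟨ +-identityʳ (X m) ⟨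
        X m + 0           ∎))
      m≡0 = m*n≡0⇒m≡0 m a (m+n≡0⇒m≡0 _ ma+c≡0)
      c≡0 = m+n≡0⇒n≡0 (m * a) ma+c≡0
      n≡0 = n≤0⇒n≡0 (subst (n ≤_) m≡0 n≤m)

  Covered : ℕ → Set
  Covered v = (∃[ n ] v ≡ X n) ⊎ (∃[ n ] v ≡ Y n)

  covered-below : ∀ n {v} → v ≤ X n → Covered v
  covered-below zero    v≤0 = inj₁ (0 , n≤0⇒n≡0 v≤0)
  covered-below (suc n) {v} v≤ with v ≤? X n
  ... | yes v≤Xn = covered-below n v≤Xn
  ... | no  v≰Xn with X-suc n
  ...   | inj₂ (_ , X≡) = inj₁ (suc n , ≤-antisym v≤ (subst (_≤ v) (sym X≡) (≰⇒> v≰Xn)))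
  ...   | inj₁ (hit , X≡) with m≤n⇒m<n∨m≡n (subst (v ≤_) X≡ v≤)
  ...     | inj₂ v≡     = inj₁ (suc n , trans v≡ (sym X≡))
  ...     | inj₁ v<2+Xn with j , _ , Yj≡ ← Y-hit-sound n hit =
    inj₂ (j , trans (≤-antisym (s≤s⁻¹ v<2+Xn) (≰⇒> v≰Xn)) (sym Yj≡))

  cover : ∀ v → Covered v
  cover v = covered-below v (n≤X v)

  Pair : Pos → Set
  Pair p = ∃[ n ] (p ≡ (X n , Y n) ⊎ p ≡ (Y n , X n))

  Pair-swap : ∀ {x y} → Pair (x , y) → Pair (y , x)
  Pair-swap (n , inj₁ refl) = n , inj₂ refl
  Pair-swap (n , inj₂ refl) = n , inj₁ refl

  Y-offset : ∀ {m n d k} → m + d ≡ n → X n ≡ X m + k → Y n ≡ Y m + (k + d * a)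
  Y-offset {m} {d = d} {k} refl X≡ = begin
    X (m + d) + (m + d) * a + c    ≡⟨ cong (λ x → x + (m + d) * a + c) X≡ ⟩
    X m + k + (m + d) * a + c      ≡⟨ regroup (X m) k m d a c ⟩
    X m + m * a + c + (k + d * a)  ∎
    where
      open ≡-Reasoning
      regroup : ∀ x k m d a c → x + k + (m + d) * a + c ≡ x + m * a + c + (k + d * a)
      regroup = solve-∀

  Y-cross-offset : ∀ {m n k} → X n ≡ Y m + k → Y n ≡ X m + (k + (m * a + c + (n * a + c)))
  Y-cross-offset {m} {n} {k} X≡ = begin
    X n + n * a + c                        ≡⟨ cong (λ x → x + n * a + c) X≡ ⟩
    X m + m * a + c + k + n * a + c        ≡⟨ regroup (X m) (m * a) (n * a) c k ⟩
    X m + (k + (m * a + c + (n * a + c)))  ∎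
    where
      open ≡-Reasoning
      regroup : ∀ x ma na c k → x + ma + c + k + na + c ≡ x + (k + (ma + c + (na + c)))
      regroup = solve-∀

  no-move-XY→XY : ∀ {n m} → ¬ Move a (X n , Y n) (X m , Y m)
  no-move-XY→XY {n} {m} mv with k , l , Xn≡ , Yn≡ , legal ← move-elim mv with <-cmp m n
  ... | tri> _ _ n<m = <⇒≱ (X-strict n<m) (subst (X m ≤_) (sym Xn≡) (m≤m+n (X m) k))
  ... | tri≈ _ refl _ = <⇒≢ (proj₁ legal) (sym (cong₂ _+_ k≡0 l≡0))
    where
      k≡0 = sym (+-cancelˡ-≡ (X m) 0 k (trans (+-identityʳ _) Xn≡))
      l≡0 = sym (+-cancelˡ-≡ (Y m) 0 l (trans (+-identityʳ _) Yn≡))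
  ... | tri< m<n _ _ with t , 1+m+t≡n ← m≤n⇒∃[o]m+o≡n m<n =
    <⇒≢ (X-strict m<n) (sym (trans Xn≡ (trans (cong (X m +_) k≡0) (+-identityʳ (X m)))))
    where
      l≡k+far : l ≡ k + suc t * a
      l≡k+far = +-cancelˡ-≡ (Y m) l _ (trans (sym Yn≡) (Y-offset {m} {n} {suc t} (trans (+-suc m t) 1+m+t≡n) Xn≡))
      k≡0 = Legal-far⇒k≡0 (m≤m+n a (t * a)) (subst (Legal a k) l≡k+far legal)

  no-move-XY→YX : ∀ {n m} → ¬ Move a (X n , Y n) (Y m , X m)
  no-move-XY→YX {suc n} {m} mv with k , l , Xn≡ , Yn≡ , legal ← move-elim mv =
    0≢1+n (sym (proj₁ (X≡Y⇒origin {suc n} {m} (trans Xn≡ (trans (cong (Y m +_) k≡0) (+-identityʳ _))))))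
    where
      l≡k+far = +-cancelˡ-≡ (X m) l _ (trans (sym Yn≡) (Y-cross-offset {m} {suc n} Xn≡))
      a≤far : a ≤ m * a + c + (suc n * a + c)
      a≤far = ≤-trans (≤-trans (m≤m+n a (n * a)) (m≤m+n _ c)) (m≤n+m _ (m * a + c))
      k≡0 = Legal-far⇒k≡0 a≤far (subst (Legal a k) l≡k+far legal)
  no-move-XY→YX {zero} {m} mv with k , l , Xn≡ , Yn≡ , legal ← move-elim mv =
    <⇒≢ (proj₁ legal) (sym (cong₂ _+_ k≡0 l≡0))
    where
      k≡0 = m+n≡0⇒n≡0 (Y m) (sym Xn≡)
      c≡0 = proj₂ (proj₂ (X≡Y⇒origin {0} {m} (sym (m+n≡0⇒m≡0 (Y m) (sym Xn≡)))))
      l≡0 = m+n≡0⇒n≡0 (X m) (trans (sym Yn≡) c≡0)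

  no-move-from-XY : ∀ n {q} → Pair q → ¬ Move a (X n , Y n) q
  no-move-from-XY n (m , inj₁ refl) = no-move-XY→XY {n} {m}
  no-move-from-XY n (m , inj₂ refl) = no-move-XY→YX {n} {m}

  Pair-independent : Independent a Pair
  Pair-independent (n , inj₁ refl) q∈ mv = no-move-from-XY n q∈ mv
  Pair-independent (n , inj₂ refl) q∈ mv = no-move-from-XY n (Pair-swap q∈) (Move-swap mv)

  Absorbed-swap : ∀ {x y} → Absorbed a Pair (x , y) → Absorbed a Pair (y , x)
  Absorbed-swap (inj₁ xy∈) = inj₁ (Pair-swap xy∈)
  Absorbed-swap (inj₂ (_ , mv , q∈)) = inj₂ (_ , Move-swap mv , Pair-swap q∈)

  absorbed-above : ∀ {x w y} → Pair (x , w) → w ≤ y → Absorbed a Pair (x , y)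
  absorbed-above {x} {w} xw∈ w≤y with m≤n⇒∃[o]m+o≡n w≤y
  ... | zero  , w+0≡y = inj₁ (subst (λ y → Pair (x , y)) (trans (sym (+-identityʳ w)) w+0≡y) xw∈)
  ... | suc t , w+t≡y = inj₂ (_ , move-intro (sym (+-identityʳ x)) (sym w+t≡y) (Legal-single t) , xw∈)

  absorbed-diagonal : 2 ≤ a → c ≡ 1 → ∀ x → (x , x) ≡ (0 , 0) ⊎ Absorbed a Pair (x , x)
  absorbed-diagonal 2≤a c≡1 zero    = inj₁ refl
  absorbed-diagonal 2≤a c≡1 (suc x) =
    inj₂ (inj₂ (_ , move-intro refl refl (Legal-adjacent 2≤a x) , (0 , inj₁ (cong (0 ,_) (sym c≡1)))))

  -- With e = r + m a, r < a, take X n − X m from the first pile and r more than that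
  -- from the second.
  move-to-earlier-pair : ∀ {n e} → e < n * a → Move a (X n , X n + (c + e)) (X (e / a) , Y (e / a))
  move-to-earlier-pair {n} {e} e<na =
    move-intro Xn≡ y≡ (Legal-twoPile z<s (subst (_< a) (sym (∣m-m+n∣≡n (suc u) r)) (m%n<n e a)))
    where
      m = e / a
      r = e % a
      e≡ : e ≡ r + m * a
      e≡ = m≡m%n+[m/n]*n e a
      m<n : m < n
      m<n = *-cancelʳ-< a m n (≤-<-trans (subst (m * a ≤_) (sym e≡) (m≤n+m (m * a) r)) e<na)
      u = proj₁ (m≤n⇒∃[o]m+o≡n (X-strict m<n))
      Xn≡ : X n ≡ X m + suc u
      Xn≡ = sym (trans (+-suc (X m) u) (proj₂ (m≤n⇒∃[o]m+o≡n (X-strict m<n))))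
      y≡ : X n + (c + e) ≡ Y m + (suc u + r)
      y≡ = begin
        X n + (c + e)                     ≡⟨ cong₂ (λ x e → x + (c + e)) Xn≡ e≡ ⟩
        X m + suc u + (c + (r + m * a))   ≡⟨ regroup (X m) (suc u) c r (m * a) ⟩
        X m + m * a + c + (suc u + r)     ∎
        where
          open ≡-Reasoning
          regroup : ∀ x s c r ma → x + s + (c + (r + ma)) ≡ x + ma + c + (s + r)
          regroup = solve-∀

  absorbed-below : 2 ≤ a → c ≤ 1 → ∀ {n y} → X n ≤ y → y < Y n →
                   (X n , y) ≡ (0 , 0) ⊎ Absorbed a Pair (X n , y)
  absorbed-below 2≤a c≤1 {n} {y} Xn≤y y<Yn with d , Xn+d≡y ← m≤n⇒∃[o]m+o≡n Xn≤y with d <? c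
  ... | yes d<c = subst (λ y → (X n , y) ≡ (0 , 0) ⊎ Absorbed a Pair (X n , y)) Xn≡y
                        (absorbed-diagonal 2≤a c≡1 (X n))
    where
      c≡1 = ≤-antisym c≤1 (≤-trans (s≤s z≤n) d<c)
      Xn≡y = trans (sym (+-identityʳ (X n))) (trans (cong (X n +_) (sym (n<1⇒n≡0 (<-≤-trans d<c c≤1)))) Xn+d≡y)
  ... | no d≮c with e , c+e≡d ← m≤n⇒∃[o]m+o≡n (≮⇒≥ d≮c) =
    inj₂ (inj₂ (_ , subst (λ y → Move a (X n , y) _) y≡ (move-to-earlier-pair {n} e<na) , (e / a , inj₁ refl)))
    where
      y≡ : X n + (c + e) ≡ y
      y≡ = trans (cong (X n +_) c+e≡d) Xn+d≡y
      e<na : e < n * a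
      e<na = +-cancelˡ-< c e (n * a) (+-cancelˡ-< (X n) _ _ (begin-strict
        X n + (c + e)     ≡⟨ y≡ ⟩
        y                 <⟨ y<Yn ⟩
        X n + n * a + c   ≡⟨ regroup (X n) (n * a) c ⟩
        X n + (c + n * a) ∎))
        where
          open ≤-Reasoning
          regroup : ∀ x na c → x + na + c ≡ x + (c + na)
          regroup = solve-∀

  absorbing-≤ : 2 ≤ a → c ≤ 1 → ∀ {x y} → x ≤ y → (x , y) ≡ (0 , 0) ⊎ Absorbed a Pair (x , y)
  absorbing-≤ 2≤a c≤1 {x} {y} x≤y with cover x
  ... | inj₂ (n , refl) = inj₂ (absorbed-above (n , inj₂ refl) (≤-trans (X≤Y n) x≤y))
  ... | inj₁ (n , refl) with Y n ≤? y
  ...   | yes Yn≤y = inj₂ (absorbed-above (n , inj₁ refl) Yn≤y)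
  ...   | no  Yn≰y = absorbed-below 2≤a c≤1 {n} x≤y (≰⇒> Yn≰y)

  Pair-absorbing : 2 ≤ a → c ≤ 1 → ∀ p → p ≡ (0 , 0) ⊎ Absorbed a Pair p
  Pair-absorbing 2≤a c≤1 (x , y) with ≤-total x y
  ... | inj₁ x≤y = absorbing-≤ 2≤a c≤1 x≤y
  ... | inj₂ y≤x = Sum.map (cong Product.swap) Absorbed-swap (absorbing-≤ 2≤a c≤1 y≤x)

*-≢-1+* : ∀ {a} → 2 ≤ a → ∀ m n → m * a ≢ 1 + n * a
*-≢-1+* {a} 2≤a m n eq = 0≢1+n (begin
  0                   ≡⟨ m*n%n≡0 m a ⟨
  (m * a) % a         ≡⟨ cong (_% a) eq ⟩
  (1 + n * a) % a     ≡⟨ [m+kn]%n≡m%n 1 n a ⟩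
  1 % a               ≡⟨ m<n⇒m%n≡m 2≤a ⟩
  1                   ∎)
  where
    open ≡-Reasoning
    instance _ = >-nonZero (<-trans z<s 2≤a)

module _ (b : ℕ) where
  private
    module P₀ = WythoffPairs (suc b) 0
    module P₁ = WythoffPairs (suc b) 1

    a = suc (suc b)

    same-orientation : ∀ n m → P₀.X n ≡ P₁.X m → P₀.Y n ≡ P₁.Y m → ⊥
    same-orientation n m X≡ Y≡ = *-≢-1+* (s≤s (s≤s z≤n)) n m (+-cancelˡ-≡ (P₁.X m) _ _ (begin
      P₁.X m + n * a           ≡⟨ cong (_+ n * a) X≡ ⟨
      P₀.X n + n * a           ≡⟨ +-identityʳ _ ⟨
      P₀.Y n                   ≡⟨ Y≡ ⟩
      P₁.X m + m * a + 1       ≡⟨ regroup (P₁.X m) (m * a) ⟩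
      P₁.X m + (1 + m * a)     ∎))
      where
        open ≡-Reasoning
        regroup : ∀ x ma → x + ma + 1 ≡ x + (1 + ma)
        regroup = solve-∀

    cross-orientation : ∀ n m → P₀.X n ≡ P₁.Y m → P₀.Y n ≡ P₁.X m → ⊥
    cross-orientation n m X≡ Y≡ =
      <⇒≱ (P₁.X<Y ≤-refl m) (subst₂ _≤_ X≡ Y≡ (P₀.X≤Y n))

  Pair₀-Pair₁-disjoint : ∀ {p} → P₀.Pair p → ¬ P₁.Pair p
  Pair₀-Pair₁-disjoint (n , inj₁ refl) (m , inj₁ eq) = same-orientation n m (,-injectiveˡ eq) (,-injectiveʳ eq)
  Pair₀-Pair₁-disjoint (n , inj₁ refl) (m , inj₂ eq) = cross-orientation n m (,-injectiveˡ eq) (,-injectiveʳ eq)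
  Pair₀-Pair₁-disjoint (n , inj₂ refl) (m , inj₁ eq) = cross-orientation n m (,-injectiveʳ eq) (,-injectiveˡ eq)
  Pair₀-Pair₁-disjoint (n , inj₂ refl) (m , inj₂ eq) = same-orientation n m (,-injectiveʳ eq) (,-injectiveˡ eq)

proposition6p11 : (a : ℕ) → 2 ≤ a → StronglyMiserable a
proposition6p11 1 (s≤s ())
proposition6p11 (suc (suc b)) 2≤a =
  TwoKernels.stronglyMiserable a P₀.Pair P₁.Pair P₀.Pair-independent P₁.Pair-independent
    Pair₀-absorbing (P₁.Pair-absorbing 2≤a ≤-refl) (Pair₀-Pair₁-disjoint b)
  where
    a = suc (suc b)
    module P₀ = WythoffPairs (suc b) 0
    module P₁ = WythoffPairs (suc b) 1

    Pair₀-absorbing : ∀ p → Absorbed a P₀.Pair p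
    Pair₀-absorbing p with P₀.Pair-absorbing 2≤a z≤n p
    ... | inj₁ refl     = inj₁ (0 , inj₁ refl)
    ... | inj₂ absorbed = absorbed
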